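{- For every C-system $CC$, the unital pre-B-system $uB(CC)$ is a unital B0-system.
   Context: C-systems: a C0-system is a category $CC$ with a function $l:Ob(CC)\to\mathbb{N}$, an object $pt$, a function $ft:Ob\to Ob$, morphisms $p_X:X\to ft(X)$, and for $l(X)>0$ and $f:Y\to ft(X)$ an object $f^*X$ and morphism $q(f,X):f^*X\to X$, such that: $pt$ is the only object of length $0$; $l(ft X)=l(X)-1$ for $l(X)>0$ and $ft(pt)=pt$; $pt$ is final; for $l(X)>0$, $f:Y\to ft(X)$: $l(f^*X)>0$, $ft(f^*X)=Y$, $p_X\circ q(f,X)=f\circ p_{f^*X}$ and this square is a pullback; $(id_{ft X})^*X=X$, $q(id,X)=id_X$; $(f\circ g)^*X=g^*(f^*X)$ and $q(f\circ g,X)=q(f,X)\circ q(g,f^*X)$. A C-system is a C0-system with, for every $f:Y\to X$ with $l(X)>0$, a morphism $s_f:Y\to(ft(f))^*X$, $ft(f):=p_X\circ f$, with $p_{(ft f)^*X}\circ s_f=id_Y$, $q(ft f,X)\circ s_f=f$, and $s_f=s_{q(g,U)\circ f}$ whenever $X=g^*U$ with $g:ft(X)\to ft(U)$. Pre-B-systems: a non-unital pre-B-system consists of sets $B_n,\widetilde B_{n+1}$ ($n\ge0$), maps $ft:B_{n+1}\to B_n$, $\partial:\widetilde B_{n+1}\to B_{n+1}$, $pt\in B_0$, and for $m\ge n\ge 0$ maps $T(Y,X)\in B_{m+2}$ for $Y\in B_{n+1},X\in B_{m+1}$, $ft(Y)=ft^{m+1-n}(X)$; $\widetilde T(Y,r)\in\widetilde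 B_{m+2}$ for $Y\in B_{n+1},r\in\widetilde B_{m+1}$, $ft(Y)=ft^{m+1-n}(\partial r)$; $S(s,X)\in B_{m+1}$ for $s\in\widetilde B_{n+1},X\in B_{m+2}$, $\partial(s)=ft^{m+1-n}(X)$; $\widetilde S(s,r)\in\widetilde B_{m+1}$ for $s\in\widetilde B_{n+1},r\in\widetilde B_{m+2}$, $\partial(s)=ft^{m+1-n}(\partial r)$. A unital one also has $\delta:B_{n+1}\to\widetilde B_{n+2}$. A non-unital B0-system is a non-unital pre-B-system such that (for all $m\ge n\ge0$ and arguments in the domains above): (1) $B_0=\{pt\}$; (2) $ft(T(Y,X))=T(Y,ft(X))$ if $m>n$ and $=Y$ if $m=n$; (3) $\partial(\widetilde T(Y,r))=T(Y,\partial r)$; (4) $ft(S(s,X))=S(s,ft(X))$ if $m>n$ and $=ft(\partial(s))$ if $m=n$; (5) $\partial(\widetilde S(s,r))=S(s,\partial r)$. A unital B0-system is a unital pre-B-system whose underlying non-unital one is a B0-system and with $\partial(\delta(X))=T(X,X)$ for all $X\in B_{n+1}$. $uB(CC)$: $B_n=\{X\mid l(X)=n\}$, $\widetilde B_{n+1}=\{(X,s)\mid l(X)=n+1,\ s:ft(X)\to X,\ p_X\circ s=id\}$, $ft$ restricted, $\partial(X,s)=X$, $pt=pt$. With $f^*(X,0)=Y$, $q(f,X,0)=f$, $f^*(X,i+1)=q(f,ftX,i)^*(X)$, $q(f,X,i+1)=q(q(f,ftX,i),X)$ (for $f:Y\to ft^i(X)$); $g^*(s):W\to g^*X$ the unique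 morphism with $p_{g^*X}\circ g^*(s)=id_W$, $q(g,X)\circ g^*(s)=s\circ g$ (for a section $s$ of $p_X$, $g:W\to ft X$); $f^*(s,i)=q(f,ftX,i-1)^*(s)$: $T(Y,X)=p_Y^*(X,m+1-n)$, $\widetilde T(Y,(X,s))=(p_Y^*(X,m+1-n),p_Y^*(s,m+1-n))$, $S((Z,s),X)=s^*(X,m+1-n)$, $\widetilde S((Z,s),(X,r))=(s^*(X,m+1-n),s^*(r,m+1-n))$, and $\delta(X)=(p_X^*X,d_X)$ with $d_X:X\to p_X^*X$ the unique morphism with $p_{p_X^*X}\circ d_X=id_X$ and $q(p_X,X)\circ d_X=id_X$. -}

module Defs where

open import Level using (Level; _⊔_) renaming (suc to lsuc)
open import Data.Nat using (ℕ; zero; suc; _+_; _∸_; _≤_; _<_; z≤n; s≤s)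
open import Data.Nat.Properties using (+-suc; ≤-trans; m≤m+n; ∸-monoˡ-≤)
open import Data.Product using (Σ; Σ-syntax; _×_; _,_; proj₁; proj₂)
open import Relation.Binary.PropositionalEquality
  using (_≡_; refl; sym; trans; cong; subst)

record Category (o h : Level) : Set (lsuc (o ⊔ h)) where
  infixr 9 _∘_
  field
    Ob    : Set o
    Hom   : Ob → Ob → Set h
    id    : ∀ {X} → Hom X X
    _∘_   : ∀ {X Y Z} → Hom Y Z → Hom X Y → Hom X Z
    idˡ   : ∀ {X Y} (f : Hom X Y) → id ∘ f ≡ f
    idʳ   : ∀ {X Y} (f : Hom X Y) → f ∘ id ≡ f
    assoc : ∀ {W X Y Z} (f : Hom Y Z) (g : Hom X Y) (k : Hom W X) →
            (f ∘ g) ∘ k ≡ f ∘ (g ∘ k)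

module CatNotions {o h} (C : Category o h) where
  open Category C

  IsFinal : Ob → Set (o ⊔ h)
  IsFinal T = ∀ X → Σ[ t ∈ Hom X T ] (∀ (t' : Hom X T) → t' ≡ t)

  IsPullback : ∀ {P A B D} → Hom P A → Hom P B → Hom A D → Hom B D → Set (o ⊔ h)
  IsPullback {P} {A} {B} pa pb f g =
    ∀ {W} (a : Hom W A) (b : Hom W B) → f ∘ a ≡ g ∘ b →
    Σ[ u ∈ Hom W P ] ((pa ∘ u ≡ a × pb ∘ u ≡ b)
                      × (∀ (u' : Hom W P) → pa ∘ u' ≡ a → pb ∘ u' ≡ b → u' ≡ u))

  substDom : ∀ {X X' Y} → X ≡ X' → Hom X Y → Hom X' Y
  substDom {Y = Y} e f = subst (λ Z → Hom Z Y) e f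

  substCod : ∀ {X Y Y'} → Y ≡ Y' → Hom X Y → Hom X Y'
  substCod {X = X} e f = subst (Hom X) e f

-- the data of a C0-system; f^*X and q(f,X) are only given when l(X) > 0
record C0Data {o h} (C : Category o h) : Set (o ⊔ h) where
  open Category C
  field
    l    : Ob → ℕ
    pt   : Ob
    ft   : Ob → Ob
    p    : (X : Ob) → Hom X (ft X)
    star : (X : Ob) → .(0 < l X) → ∀ {Y} → Hom Y (ft X) → Ob
    q    : (X : Ob) .(pos : 0 < l X) {Y : Ob} (f : Hom Y (ft X)) → Hom (star X pos f) X

record IsC0System {o h} (C : Category o h) (D : C0Data C) : Set (o ⊔ h) where
  open Category C
  open CatNotions C
  open C0Data D
  field
    pt-len     : l pt ≡ 0
    pt-unique  : ∀ X → l X ≡ 0 → X ≡ pt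
    l-ft       : ∀ X → 0 < l X → l (ft X) ≡ l X ∸ 1
    ft-pt      : ft pt ≡ pt
    pt-final   : IsFinal pt
    l-star     : ∀ X .(pos : 0 < l X) {Y} (f : Hom Y (ft X)) → 0 < l (star X pos f)
    ft-star    : ∀ X .(pos : 0 < l X) {Y} (f : Hom Y (ft X)) → ft (star X pos f) ≡ Y
  p↓ : ∀ X .(pos : 0 < l X) {Y} (f : Hom Y (ft X)) → Hom (star X pos f) Y
  p↓ X pos f = substCod (ft-star X pos f) (p (star X pos f))
  field
    square     : ∀ X .(pos : 0 < l X) {Y} (f : Hom Y (ft X)) →
                 p X ∘ q X pos f ≡ f ∘ p↓ X pos f
    pullback   : ∀ X .(pos : 0 < l X) {Y} (f : Hom Y (ft X)) →
                 IsPullback (q X pos f) (p↓ X pos f) (p X) f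
    star-id    : ∀ X .(pos : 0 < l X) → star X pos (id {ft X}) ≡ X
    q-id       : ∀ X .(pos : 0 < l X) →
                 substDom (star-id X pos) (q X pos (id {ft X})) ≡ id
    star-comp  : ∀ X .(pos : 0 < l X) {Y W} (f : Hom Y (ft X)) (g : Hom W Y) →
                 star X pos (f ∘ g)
                   ≡ star (star X pos f) (l-star X pos f)
                          (substCod (sym (ft-star X pos f)) g)
    q-comp     : ∀ X .(pos : 0 < l X) {Y W} (f : Hom Y (ft X)) (g : Hom W Y) →
                 substDom (star-comp X pos f g) (q X pos (f ∘ g))
                   ≡ q X pos f ∘ q (star X pos f) (l-star X pos f)
                                   (substCod (sym (ft-star X pos f)) g)

record C0System {o h} (C : Category o h) : Set (o ⊔ h) where
  field
    dat : C0Data C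
    isC0 : IsC0System C dat
  open C0Data dat public
  open IsC0System isC0 public

record CSystem {o h} (C : Category o h) : Set (o ⊔ h) where
  open Category C
  field
    c0 : C0System C
  open C0System c0
  field
    -- s_f : Y → (ft f)^* X  for f : Y → X with l(X) > 0, where ft f = p_X ∘ f
    sec   : ∀ {Y X} .(pos : 0 < l X) (f : Hom Y X) → Hom Y (star X pos (p X ∘ f))
    sec-p : ∀ {Y X} .(pos : 0 < l X) (f : Hom Y X) → p↓ X pos (p X ∘ f) ∘ sec pos f ≡ id
    sec-q : ∀ {Y X} .(pos : 0 < l X) (f : Hom Y X) → q X pos (p X ∘ f) ∘ sec pos f ≡ f
    -- s_f = s_{q(g,U) ∘ f} when X = g^*U, g : ft X → ft U; the two codomains are
    -- equal objects (by the C0 axioms), and the equation is stated along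
    -- (any, hence the) proof of that equality
    sec-nat : ∀ U .(posU : 0 < l U) {Z} (g : Hom Z (ft U)) {Y}
              (f : Hom Y (star U posU g))
              (e : star (star U posU g) (l-star U posU g) (p (star U posU g) ∘ f)
                   ≡ star U posU (p U ∘ (q U posU g ∘ f))) →
              subst (Hom Y) e (sec (l-star U posU g) f) ≡ sec posU (q U posU g ∘ f)
  open C0System c0 public

-- Pre-B-systems.  The quantification "m ≥ n" is encoded by a proof of
-- n ≼ m (an inductive ≤ counting the steps), and B̃ n stands for B̃_{n+1}.

data _≼_ (n : ℕ) : ℕ → Set where
  ≼-refl : n ≼ n
  ≼-step : ∀ {m} → n ≼ m → n ≼ suc m

s≼s : ∀ {n m} → n ≼ m → suc n ≼ suc m
s≼s ≼-refl     = ≼-refl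
s≼s (≼-step p) = ≼-step (s≼s p)

ft* : ∀ {a} (B : ℕ → Set a) (ft : ∀ {n} → B (suc n) → B n) →
      ∀ {n m} → n ≼ m → B m → B n
ft* B ft ≼-refl     X = X
ft* B ft (≼-step p) X = ft* B ft p (ft X)

record PreB (a b : Level) : Set (lsuc (a ⊔ b)) where
  field
    B  : ℕ → Set a
    B̃  : ℕ → Set b                       -- B̃ n  is  B̃_{n+1}
    ft : ∀ {n} → B (suc n) → B n
    ∂  : ∀ {n} → B̃ n → B (suc n)
    pt : B 0
    -- m ≥ n, Y ∈ B_{n+1}, X ∈ B_{m+1}, ft Y = ft^{m+1-n} X ; result in B_{m+2}
    T  : ∀ {n m} (le : n ≼ m) (Y : B (suc n)) (X : B (suc m)) →
         ft Y ≡ ft* B ft le (ft X) → B (suc (suc m))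
    -- Y ∈ B_{n+1}, r ∈ B̃_{m+1}, ft Y = ft^{m+1-n} (∂ r) ; result in B̃_{m+2}
    T̃  : ∀ {n m} (le : n ≼ m) (Y : B (suc n)) (r : B̃ m) →
         ft Y ≡ ft* B ft le (ft (∂ r)) → B̃ (suc m)
    -- s ∈ B̃_{n+1}, X ∈ B_{m+2}, ∂ s = ft^{m+1-n} X ; result in B_{m+1}
    S  : ∀ {n m} (le : n ≼ m) (s : B̃ n) (X : B (suc (suc m))) →
         ∂ s ≡ ft* B ft (s≼s le) (ft X) → B (suc m)
    -- s ∈ B̃_{n+1}, r ∈ B̃_{m+2}, ∂ s = ft^{m+1-n} (∂ r) ; result in B̃_{m+1}
    S̃  : ∀ {n m} (le : n ≼ m) (s : B̃ n) (r : B̃ (suc m)) →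
         ∂ s ≡ ft* B ft (s≼s le) (ft (∂ r)) → B̃ m

record UPreB (a b : Level) : Set (lsuc (a ⊔ b)) where
  field
    pre : PreB a b
  open PreB pre public
  field
    δ : ∀ {n} → B (suc n) → B̃ (suc n)    -- δ : B_{n+1} → B̃_{n+2}

record IsB0 {a b} (P : PreB a b) : Set (a ⊔ b) where
  open PreB P
  field
    ax1  : ∀ (X : B 0) → X ≡ pt
    ax2> : ∀ {n m} (le : n ≼ m) (Y : B (suc n)) (X : B (suc (suc m)))
             (e : ft Y ≡ ft* B ft (≼-step le) (ft X)) →
             ft (T (≼-step le) Y X e) ≡ T le Y (ft X) e
    ax2= : ∀ {n} (Y : B (suc n)) (X : B (suc n)) (e : ft Y ≡ ft X) →
             ft (T ≼-refl Y X e) ≡ Y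
    ax3  : ∀ {n m} (le : n ≼ m) (Y : B (suc n)) (r : B̃ m)
             (e : ft Y ≡ ft* B ft le (ft (∂ r))) →
             ∂ (T̃ le Y r e) ≡ T le Y (∂ r) e
    ax4> : ∀ {n m} (le : n ≼ m) (s : B̃ n) (X : B (suc (suc (suc m))))
             (e : ∂ s ≡ ft* B ft (s≼s (≼-step le)) (ft X)) →
             ft (S (≼-step le) s X e) ≡ S le s (ft X) e
    ax4= : ∀ {n} (s : B̃ n) (X : B (suc (suc n)))
             (e : ∂ s ≡ ft X) →
             ft (S ≼-refl s X e) ≡ ft (∂ s)
    ax5  : ∀ {n m} (le : n ≼ m) (s : B̃ n) (r : B̃ (suc m))
             (e : ∂ s ≡ ft* B ft (s≼s le) (ft (∂ r))) →
             ∂ (S̃ le s r e) ≡ S le s (∂ r) e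

record IsUnitalB0 {a b} (P : UPreB a b) : Set (a ⊔ b) where
  open UPreB P
  field
    isB0 : IsB0 pre
    ax-δ : ∀ {n} (X : B (suc n)) → ∂ (δ X) ≡ T ≼-refl X X refl

diff : ∀ {n m} → n ≼ m → ℕ
diff ≼-refl     = 0
diff (≼-step p) = suc (diff p)

diff-+ : ∀ {n m} (le : n ≼ m) → diff le + n ≡ m
diff-+ ≼-refl     = refl
diff-+ (≼-step p) = cong suc (diff-+ p)

private
  suc-∸1 : ∀ {L} → 0 < L → suc (L ∸ 1) ≡ L
  suc-∸1 (s≤s _) = refl

  +≡⇒≤ : ∀ {d k m} → d + k ≡ m → d ≤ m
  +≡⇒≤ {d} {k} eq = subst (d ≤_) eq (m≤m+n d k)

module UB {o h} {C : Category o h} (CS : CSystem C) where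
  open Category C
  open CatNotions C
  open CSystem CS

  ftⁿ : ℕ → Ob → Ob
  ftⁿ zero    X = X
  ftⁿ (suc i) X = ftⁿ i (ft X)

  len-ft : ∀ X {n} → l X ≡ suc n → l (ft X) ≡ n
  len-ft X {n} e = trans (l-ft X (subst (0 <_) (sym e) (s≤s z≤n)))
                         (cong (_∸ 1) e)

  len-star : ∀ X .(pos : 0 < l X) {Y} (f : Hom Y (ft X)) → l (star X pos f) ≡ suc (l Y)
  len-star X pos {Y} f =
    trans (sym (suc-∸1 (l-star X pos f)))
          (cong suc (trans (sym (l-ft (star X pos f) (l-star X pos f)))
                           (cong l (ft-star X pos f))))

  private
    pos-of : ∀ {i X} → suc i ≤ l X → 0 < l X
    pos-of le = ≤-trans (s≤s z≤n) le

    le-of : ∀ {i} X → suc i ≤ l X → i ≤ l (ft X)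
    le-of X le = subst (_ ≤_) (sym (l-ft X (pos-of le))) (∸-monoˡ-≤ 1 le)

  -- f^*(X,i) and q(f,X,i) for f : Y → ft^i X  (defined for i ≤ l X)
  iter-star : ∀ (i : ℕ) (X : Ob) → .(i ≤ l X) → ∀ {Y} → Hom Y (ftⁿ i X) → Ob
  iter-q    : ∀ (i : ℕ) (X : Ob) .(le : i ≤ l X) {Y} (f : Hom Y (ftⁿ i X)) →
              Hom (iter-star i X le f) X
  iter-star zero    X le {Y} f = Y
  iter-star (suc i) X le     f = star X (pos-of le) (iter-q i (ft X) (le-of X le) f)
  iter-q zero    X le f = f
  iter-q (suc i) X le f = q X (pos-of le) (iter-q i (ft X) (le-of X le) f)

  len-iter : ∀ i X .(le : i ≤ l X) {Y} (f : Hom Y (ftⁿ i X)) →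
             l (iter-star i X le f) ≡ i + l Y
  len-iter zero    X le f = refl
  len-iter (suc i) X le f =
    trans (len-star X (pos-of le) (iter-q i (ft X) (le-of X le) f))
          (cong suc (len-iter i (ft X) (le-of X le) f))

  -- g^*(s) for a section s of p_X and g : W → ft X : the unique u : W → g^*X
  -- with p_{g^*X} ∘ u = id_W and q(g,X) ∘ u = s ∘ g
  pb-sec-cone : ∀ X {W} (g : Hom W (ft X)) (s : Hom (ft X) X) → p X ∘ s ≡ id →
                p X ∘ (s ∘ g) ≡ g ∘ id
  pb-sec-cone X g s ps =
    trans (sym (assoc _ _ _)) (trans (cong (_∘ g) ps) (trans (idˡ g) (sym (idʳ g))))

  pb-sec : ∀ X .(pos : 0 < l X) {W} (g : Hom W (ft X)) (s : Hom (ft X) X) →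
           p X ∘ s ≡ id → Hom W (star X pos g)
  pb-sec X pos g s ps = proj₁ (pullback X pos g (s ∘ g) id (pb-sec-cone X g s ps))

  pb-sec-p : ∀ X .(pos : 0 < l X) {W} (g : Hom W (ft X)) (s : Hom (ft X) X)
             (ps : p X ∘ s ≡ id) → p↓ X pos g ∘ pb-sec X pos g s ps ≡ id
  pb-sec-p X pos g s ps =
    proj₂ (proj₁ (proj₂ (pullback X pos g (s ∘ g) id (pb-sec-cone X g s ps))))

  private
    sec-transport : ∀ {A W P} (e : A ≡ W) (pp : Hom P A) (u : Hom W P) →
                    substCod e pp ∘ u ≡ id → pp ∘ substDom (sym e) u ≡ id
    sec-transport refl pp u eq = eq

  -- f^*(s,i) = q(f,ftX,i-1)^*(s), as a section of p over f^*(X,i), i ≥ 1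
  iter-sec : ∀ j X .(le : suc j ≤ l X) {Y} (f : Hom Y (ftⁿ (suc j) X))
             (s : Hom (ft X) X) → p X ∘ s ≡ id →
             Σ[ s' ∈ Hom (ft (iter-star (suc j) X le f)) (iter-star (suc j) X le f) ]
               p (iter-star (suc j) X le f) ∘ s' ≡ id
  iter-sec j X le f s ps =
    let g = iter-q j (ft X) (le-of X le) f
        e = ft-star X (pos-of le) g
        u = pb-sec X (pos-of le) g s ps
    in substDom (sym e) u
     , sec-transport e (p (star X (pos-of le) g)) u (pb-sec-p X (pos-of le) g s ps)

  Bₙ : ℕ → Set o
  Bₙ n = Σ[ X ∈ Ob ] l X ≡ n

  B̃ₙ : ℕ → Set (o ⊔ h)      -- B̃ₙ n is B̃_{n+1}
  B̃ₙ n = Σ[ X ∈ Ob ] Σ[ e ∈ l X ≡ suc n ] Σ[ s ∈ Hom (ft X) X ] p X ∘ s ≡ id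

  ftB : ∀ {n} → Bₙ (suc n) → Bₙ n
  ftB (X , e) = ft X , len-ft X e

  ∂B : ∀ {n} → B̃ₙ n → Bₙ (suc n)
  ∂B (X , e , _) = X , e

  proj-ft* : ∀ {n m} (le : n ≼ m) (X : Bₙ m) →
             proj₁ (ft* Bₙ ftB le X) ≡ ftⁿ (diff le) (proj₁ X)
  proj-ft* ≼-refl     X = refl
  proj-ft* (≼-step p) X = proj-ft* p (ftB X)

  private
    le-T : ∀ {n m} (le : n ≼ m) X → l X ≡ suc m → suc (diff le) ≤ l X
    le-T {n} le X eX = subst (_ ≤_) (sym eX) (s≤s (+≡⇒≤ (diff-+ le)))

    len-T : ∀ {n m} (le : n ≼ m) → suc (diff le) + suc n ≡ suc (suc m)
    len-T {n} le = cong suc (trans (+-suc (diff le) n) (cong suc (diff-+ le)))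

    len-S : ∀ {n m} (le : suc n ≼ suc m) → suc (diff le) + n ≡ suc m
    len-S {n} le = trans (sym (+-suc (diff le) n)) (diff-+ le)

  pY : ∀ {n m} (le : n ≼ m) (Y : Bₙ (suc n)) (X : Bₙ (suc m)) →
       ftB Y ≡ ft* Bₙ ftB le (ftB X) → Hom (proj₁ Y) (ftⁿ (suc (diff le)) (proj₁ X))
  pY le (Y , eY) (X , eX) e =
    substCod (trans (cong proj₁ e) (proj-ft* le (ftB (X , eX)))) (p Y)

  sZ : ∀ {n m} (le : n ≼ m) (s : B̃ₙ n) (X : Bₙ (suc (suc m))) →
       ∂B s ≡ ft* Bₙ ftB (s≼s le) (ftB X) →
       Hom (ft (proj₁ s)) (ftⁿ (suc (diff (s≼s le))) (proj₁ X))
  sZ le (Z , eZ , s , ps) (X , eX) e =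
    substCod (trans (cong proj₁ e) (proj-ft* (s≼s le) (ftB (X , eX)))) s

  TB : ∀ {n m} (le : n ≼ m) (Y : Bₙ (suc n)) (X : Bₙ (suc m)) →
       ftB Y ≡ ft* Bₙ ftB le (ftB X) → Bₙ (suc (suc m))
  TB le (Y , eY) (X , eX) e =
    iter-star (suc (diff le)) X (le-T le X eX) (pY le (Y , eY) (X , eX) e)
    , trans (len-iter (suc (diff le)) X (le-T le X eX) (pY le (Y , eY) (X , eX) e))
            (trans (cong (suc (diff le) +_) eY) (len-T le))

  T̃B : ∀ {n m} (le : n ≼ m) (Y : Bₙ (suc n)) (r : B̃ₙ m) →
       ftB Y ≡ ft* Bₙ ftB le (ftB (∂B r)) → B̃ₙ (suc m)
  T̃B le Y (X , eX , s , ps) e =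
    proj₁ (TB le Y (X , eX) e) , proj₂ (TB le Y (X , eX) e)
    , iter-sec (diff le) X (le-T le X eX) (pY le Y (X , eX) e) s ps

  SB : ∀ {n m} (le : n ≼ m) (s : B̃ₙ n) (X : Bₙ (suc (suc m))) →
       ∂B s ≡ ft* Bₙ ftB (s≼s le) (ftB X) → Bₙ (suc m)
  SB le (Z , eZ , s , ps) (X , eX) e =
    iter-star (suc (diff (s≼s le))) X (le-T (s≼s le) X eX) (sZ le (Z , eZ , s , ps) (X , eX) e)
    , trans (len-iter (suc (diff (s≼s le))) X (le-T (s≼s le) X eX)
                      (sZ le (Z , eZ , s , ps) (X , eX) e))
            (trans (cong (suc (diff (s≼s le)) +_) (len-ft Z eZ)) (len-S (s≼s le)))

  S̃B : ∀ {n m} (le : n ≼ m) (s : B̃ₙ n) (r : B̃ₙ (suc m)) →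
       ∂B s ≡ ft* Bₙ ftB (s≼s le) (ftB (∂B r)) → B̃ₙ m
  S̃B le s (X , eX , r , pr) e =
    proj₁ (SB le s (X , eX) e) , proj₂ (SB le s (X , eX) e)
    , iter-sec (diff (s≼s le)) X (le-T (s≼s le) X eX) (sZ le s (X , eX) e) r pr

  -- δ(X) = (p_X^* X , d_X)
  δB : ∀ {n} → Bₙ (suc n) → B̃ₙ (suc n)
  δB (X , eX) =
    let pos = subst (0 <_) (sym eX) (s≤s z≤n)
        pb  = pullback X pos (p X) id id refl
        e   = ft-star X pos (p X)
    in star X pos (p X)
     , trans (len-star X pos (p X)) (cong suc eX)
     , substDom (sym e) (proj₁ pb)
     , sec-transport e (p (star X pos (p X))) (proj₁ pb) (proj₂ (proj₁ (proj₂ pb)))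

  uBpre : PreB o (o ⊔ h)
  uBpre = record
    { B = Bₙ ; B̃ = B̃ₙ ; ft = ftB ; ∂ = ∂B ; pt = pt , pt-len
    ; T = TB ; T̃ = T̃B ; S = SB ; S̃ = S̃B }

  uB : UPreB o (o ⊔ h)
  uB = record { pre = uBpre ; δ = δB }

uB : ∀ {o h} {C : Category o h} → CSystem C → UPreB o (o ⊔ h)
uB CS = UB.uB CS

module Submission where

-- The C-system CC gives a unital pre-B-system uB(CC) whose elements are
-- objects of CC paired with a proof of their length (and, for B̃, a section).
-- All B0-axioms are equalities of such elements, so they reduce to
-- equalities of underlying objects (lengths in ℕ have unique proofs).  The
-- axioms about ∂ hold by definition, since ∂ just forgets the section.  The
-- axioms about ft rest on one fact about iterated pullbacks,
--     ft (f^*(X, i+1)) = f^*(ft X, i),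
-- which is the C0-axiom ft (f^*X) = Y at the last step of the iteration,
-- together with the observation that f^*(X, i) does not depend on which
-- proof of equality of objects was used to make the codomain of f exactly
-- ft^i X (by uniqueness of identity proofs).  The unit axiom holds because
-- both sides are the object p_X^* X.

open import Defs
open import Data.Nat using (suc; _≤_; z≤n; s≤s)
open import Data.Nat.Properties using (≡-irrelevant; m≤m+n)
open import Data.Product using (_,_; proj₁)
open import Relation.Binary.PropositionalEquality using (_≡_; refl; sym; trans; cong; subst)
open import Axiom.UniquenessOfIdentityProofs.WithK using (uip)

module _ {o h} {C : Category o h} (CC : CSystem C) where
  open Category C
  open CatNotions C
  open CSystem CC
  open UB CC

  length-bound : ∀ {n m} (le : n ≼ m) X → l X ≡ suc m → suc (diff le) ≤ l X
  length-bound {n} le X eX =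
    subst (suc (diff le) ≤_) (sym eX) (s≤s (subst (diff le ≤_) (diff-+ le) (m≤m+n (diff le) n)))

  Bₙ-ext : ∀ {n} {X X' : Bₙ n} → proj₁ X ≡ proj₁ X' → X ≡ X'
  Bₙ-ext {X = X , e} {X' = .X , e'} refl = cong (X ,_) (≡-irrelevant e e')

  iter-star-transport : ∀ i X .(le : i ≤ l X) {Y A} (e e' : A ≡ ftⁿ i X)
                        (f : Hom Y A) →
                        iter-star i X le (substCod e f) ≡ iter-star i X le (substCod e' f)
  iter-star-transport i X le e e' f = cong (λ d → iter-star i X le (substCod d f)) (uip e e')

  -- ft (f^*(X, i+1)) = f^*(ft X, i): the outermost step of the iteration is a
  -- single pullback, whose ft is its base.
  ft-iter-star : ∀ i X .(le : suc i ≤ l X) .(le' : i ≤ l (ft X)) {Y}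
                 (f : Hom Y (ftⁿ (suc i) X)) →
                 ft (iter-star (suc i) X le f) ≡ iter-star i (ft X) le' f
  ft-iter-star i X le le' f = ft-star X _ _

  ft-iter-star-transport : ∀ i X .(le : suc i ≤ l X) .(le' : i ≤ l (ft X)) {Y A}
                           (e e' : A ≡ ftⁿ (suc i) X) (f : Hom Y A) →
                           ft (iter-star (suc i) X le (substCod e f))
                             ≡ iter-star i (ft X) le' (substCod e' f)
  ft-iter-star-transport i X le le' e e' f =
    trans (ft-iter-star i X le le' (substCod e f))
          (iter-star-transport i (ft X) le' e e' f)

  -- B_0 = {pt} because pt is the only object of length 0.
  -- T(Y,X) = p_Y^*(X, m+1-n) and S((Z,s),X) = s^*(X, m+1-n), so both
  -- ft-axioms are instances of the ft-iter-star lemmas; ∂ of T̃ and S̃ is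
  -- T and S by definition.
  uB-isB0 : IsB0 uBpre
  uB-isB0 = record
    { ax1  = λ { (X , eX) → Bₙ-ext (pt-unique X eX) }
    ; ax2> = λ { le (Y , _) (X , eX) _ →
                 Bₙ-ext (ft-iter-star-transport (suc (diff le)) X
                          (length-bound (≼-step le) X eX) (length-bound le (ft X) (len-ft X eX))
                          _ _ (p Y)) }
    ; ax2= = λ { (Y , _) (X , eX) _ →
                 Bₙ-ext (ft-iter-star 0 X (length-bound ≼-refl X eX) z≤n _) }
    ; ax3  = λ _ _ _ _ → refl
    ; ax4> = λ { le (_ , _ , s , _) (X , eX) _ →
                 Bₙ-ext (ft-iter-star-transport (suc (diff (s≼s le))) X
                          (length-bound (s≼s (≼-step le)) X eX)
                          (length-bound (s≼s le) (ft X) (len-ft X eX))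
                          _ _ s) }
    ; ax4= = λ { _ (X , eX) _ →
                 Bₙ-ext (ft-iter-star 0 X (length-bound ≼-refl X eX) z≤n _) }
    ; ax5  = λ _ _ _ _ → refl
    }

  -- ∂ (δ X) and T(X, X) are both the object p_X^* X.
  uB-ax-δ : ∀ {n} (X : Bₙ (suc n)) → ∂B (δB X) ≡ TB ≼-refl X X refl
  uB-ax-δ X = Bₙ-ext refl

lemma2p7 : ∀ {o h} {C : Category o h} (CC : CSystem C) → IsUnitalB0 (uB CC)
lemma2p7 CC = record { isB0 = uB-isB0 CC ; ax-δ = uB-ax-δ CC }
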